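{- Let $n\ge 1$ and $p\ge 0$. Every permutation of $\{1,\dots,n\}$ obtained from the identity permutation $12\cdots n$ by applying $p$ successive right-jumps has at most $p$ non-left-to-right-maxima.
   Context: Permutations $\sigma=\sigma_1\sigma_2\cdots\sigma_n$ of $\{1,\dots,n\}$ are written in one-line notation. A right-jump transforms $\sigma$ into $\sigma_1\cdots\sigma_{i-1}\sigma_{i+1}\cdots\sigma_j\,\sigma_i\,\sigma_{j+1}\cdots\sigma_n$ for some positions $1\le i<j\le n$: the entry $\sigma_i$ is removed and reinserted at a position to its right. A left-to-right maximum of $\sigma$ is a value $\sigma_i$ such that $\sigma_k\le\sigma_i$ for all $k\le i$; every other value of $\sigma$ is called a non-left-to-right-maximum. -}

module Defs where

open import Data.Nat using (ℕ; zero; suc; _≤_; _<_; _≤ᵇ_)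
open import Data.Nat.Properties using (_≤?_)
open import Data.List using (List; []; _∷_; length; map; upTo; filter)
open import Data.Bool using (Bool; true; false; if_then_else_)
open import Data.Product using (Σ; _×_; _,_)
open import Relation.Nullary using (¬_)
open import Relation.Binary.PropositionalEquality using (_≡_)

-- One-line notation: a permutation of {1,…,n} is the list σ₁ σ₂ ⋯ σₙ.
-- Identity permutation 1 2 ⋯ n.
identity : ℕ → List ℕ
identity n = map suc (upTo n)

removeAt : List ℕ → ℕ → List ℕ
removeAt []       _       = []
removeAt (x ∷ xs) zero    = xs
removeAt (x ∷ xs) (suc i) = x ∷ removeAt xs i

insertAt : List ℕ → ℕ → ℕ → List ℕ
insertAt xs       zero    y = y ∷ xs
insertAt []       (suc j) y = y ∷ []
insertAt (x ∷ xs) (suc j) y = x ∷ insertAt xs j y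

-- Entry at (0-based) position i (0 if out of range; only used in range).
entry : List ℕ → ℕ → ℕ
entry []       _       = 0
entry (x ∷ xs) zero    = x
entry (x ∷ xs) (suc i) = entry xs i

-- Right-jump with 0-based positions i < j < length σ:
-- σ₁⋯σᵢ₋₁σᵢ₊₁⋯σⱼσᵢσⱼ₊₁⋯σₙ (in 1-based terms).
rightJump : List ℕ → ℕ → ℕ → List ℕ
rightJump σ i j = insertAt (removeAt σ i) j (entry σ i)

data RightJump (σ : List ℕ) : List ℕ → Set where
  jump : (i j : ℕ) → i < j → j < length σ → RightJump σ (rightJump σ i j)

data Jumps : ℕ → List ℕ → List ℕ → Set where
  done : ∀ {σ} → Jumps 0 σ σ
  step : ∀ {p σ τ υ} → Jumps p σ τ → RightJump τ υ → Jumps (suc p) σ υ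

-- Number of non-left-to-right-maxima, scanning with the running maximum m
-- of the entries seen so far. A value x is a left-to-right maximum iff
-- every earlier entry is ≤ x, i.e. m ≤ x.
nonLRMaxFrom : ℕ → List ℕ → ℕ
nonLRMaxFrom m []       = 0
nonLRMaxFrom m (x ∷ xs) =
  if m ≤ᵇ x then nonLRMaxFrom x xs else suc (nonLRMaxFrom m xs)

-- Entries are ≥ 1, so starting with running maximum 0 is correct.
nonLRMax : List ℕ → ℕ
nonLRMax σ = nonLRMaxFrom 0 σ

module Submission where

open import Defs
open import Data.Nat using (ℕ; zero; suc; _+_; _≤_; _<_; _≤ᵇ_; _⊔_; z≤n; s≤s)
open import Data.Nat.Properties
open import Data.Bool using (true; false)
open import Data.List using (List; []; _∷_)
open import Data.List.Properties using (map-upTo)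
open import Data.List.Relation.Unary.Linked using (Linked; [-]; _∷_)
open import Data.List.Relation.Unary.Linked.Properties using (applyUpTo⁺₂)
open import Function using (id)
open import Relation.Nullary using (contradiction)
open import Relation.Nullary.Reflects using (ofʸ; ofⁿ)
open import Relation.Binary.PropositionalEquality using (_≡_; refl; sym; cong)

-- Moving an entry to the right can only lower the running maximum seen by the
-- entries it jumps over and leaves it unchanged elsewhere; as a smaller running
-- maximum never creates non-left-to-right maxima, only the moved entry itself
-- can become one.  So each right-jump adds at most one, and the identity has none.

private
  variable
    m m′ x : ℕ
    xs : List ℕ

nonLRMaxFrom-mono : m ≤ m′ → ∀ xs → nonLRMaxFrom m xs ≤ nonLRMaxFrom m′ xs
nonLRMaxFrom-mono m≤m′ [] = z≤n
nonLRMaxFrom-mono {m} {m′} m≤m′ (x ∷ xs)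
  with m ≤ᵇ x | ≤ᵇ-reflects-≤ m x | m′ ≤ᵇ x | ≤ᵇ-reflects-≤ m′ x
... | true  | _        | true  | _         = ≤-refl
... | false | ofⁿ m≰x  | true  | ofʸ m′≤x  = contradiction (≤-trans m≤m′ m′≤x) m≰x
... | true  | _        | false | ofⁿ m′≰x  =
  m≤n⇒m≤1+n (nonLRMaxFrom-mono (<⇒≤ (≰⇒> m′≰x)) xs)
... | false | _        | false | _         = s≤s (nonLRMaxFrom-mono m≤m′ xs)

nonLRMaxFrom-cons-< : x < m → nonLRMaxFrom m (x ∷ xs) ≡ suc (nonLRMaxFrom m xs)
nonLRMaxFrom-cons-< {x} {m} x<m with m ≤ᵇ x | ≤ᵇ-reflects-≤ m x
... | true  | ofʸ m≤x = contradiction m≤x (<⇒≱ x<m)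
... | false | _       = refl

nonLRMaxFrom-⊔-≤-cons : ∀ m x xs → nonLRMaxFrom (m ⊔ x) xs ≤ nonLRMaxFrom m (x ∷ xs)
nonLRMaxFrom-⊔-≤-cons m x xs with m ≤ᵇ x | ≤ᵇ-reflects-≤ m x
... | true  | ofʸ m≤x rewrite m≤n⇒m⊔n≡n m≤x = ≤-refl
... | false | ofⁿ m≰x rewrite m≥n⇒m⊔n≡m (<⇒≤ (≰⇒> m≰x)) = n≤1+n _

nonLRMaxFrom-cons-≤-suc-⊔ : ∀ m x xs → nonLRMaxFrom m (x ∷ xs) ≤ suc (nonLRMaxFrom (m ⊔ x) xs)
nonLRMaxFrom-cons-≤-suc-⊔ m x xs with m ≤ᵇ x | ≤ᵇ-reflects-≤ m x
... | true  | ofʸ m≤x rewrite m≤n⇒m⊔n≡n m≤x = n≤1+n _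
... | false | ofⁿ m≰x rewrite m≥n⇒m⊔n≡m (<⇒≤ (≰⇒> m≰x)) = ≤-refl

nonLRMaxFrom-insertAt : ∀ m xs j x →
  nonLRMaxFrom m (insertAt xs j x) ≤ suc (nonLRMaxFrom (m ⊔ x) xs)
nonLRMaxFrom-insertAt m xs       zero    x = nonLRMaxFrom-cons-≤-suc-⊔ m x xs
nonLRMaxFrom-insertAt m []       (suc j) x = nonLRMaxFrom-cons-≤-suc-⊔ m x []
nonLRMaxFrom-insertAt m (y ∷ ys) (suc j) x with m ≤ᵇ y | ≤ᵇ-reflects-≤ m y
... | true  | ofʸ m≤y = begin
  nonLRMaxFrom y (insertAt ys j x)      ≤⟨ nonLRMaxFrom-insertAt y ys j x ⟩
  suc (nonLRMaxFrom (y ⊔ x) ys)         ≤⟨ s≤s (nonLRMaxFrom-mono y⊔x≤m⊔x⊔y ys) ⟩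
  suc (nonLRMaxFrom (m ⊔ x ⊔ y) ys)     ≤⟨ s≤s (nonLRMaxFrom-⊔-≤-cons (m ⊔ x) y ys) ⟩
  suc (nonLRMaxFrom (m ⊔ x) (y ∷ ys))   ∎
  where
  open ≤-Reasoning
  y⊔x≤m⊔x⊔y : y ⊔ x ≤ m ⊔ x ⊔ y
  y⊔x≤m⊔x⊔y = ⊔-lub (m≤n⊔m (m ⊔ x) y) (≤-trans (m≤n⊔m m x) (m≤m⊔n (m ⊔ x) y))
... | false | ofⁿ m≰y = begin
  suc (nonLRMaxFrom m (insertAt ys j x))   ≤⟨ s≤s (nonLRMaxFrom-insertAt m ys j x) ⟩
  suc (suc (nonLRMaxFrom (m ⊔ x) ys))      ≡⟨ cong suc (sym (nonLRMaxFrom-cons-< {xs = ys} y<m⊔x)) ⟩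
  suc (nonLRMaxFrom (m ⊔ x) (y ∷ ys))      ∎
  where
  open ≤-Reasoning
  y<m⊔x : y < m ⊔ x
  y<m⊔x = <-≤-trans (≰⇒> m≰y) (m≤m⊔n m x)

nonLRMaxFrom-rightJump : ∀ m σ {i j} → i < j →
  nonLRMaxFrom m (rightJump σ i j) ≤ suc (nonLRMaxFrom m σ)
nonLRMaxFrom-rightJump m []       {j = j} _ = nonLRMaxFrom-insertAt m [] j 0
nonLRMaxFrom-rightJump m (x ∷ xs) {zero} {j} _ =
  ≤-trans (nonLRMaxFrom-insertAt m xs j x) (s≤s (nonLRMaxFrom-⊔-≤-cons m x xs))
nonLRMaxFrom-rightJump m (x ∷ xs) {suc i} {suc j} (s≤s i<j) with m ≤ᵇ x
... | true  = nonLRMaxFrom-rightJump x xs i<j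
... | false = s≤s (nonLRMaxFrom-rightJump m xs i<j)

nonLRMax-Jumps : ∀ {p σ τ} → Jumps p σ τ → nonLRMax τ ≤ p + nonLRMax σ
nonLRMax-Jumps done = ≤-refl
nonLRMax-Jumps (step {τ = τ} js (jump i j i<j _)) =
  ≤-trans (nonLRMaxFrom-rightJump 0 τ i<j) (s≤s (nonLRMax-Jumps js))

nonLRMaxFrom-linked : Linked _≤_ (m ∷ xs) → nonLRMaxFrom m xs ≡ 0
nonLRMaxFrom-linked [-] = refl
nonLRMaxFrom-linked {m} {x ∷ xs} (m≤x ∷ linked) with m ≤ᵇ x | ≤ᵇ-reflects-≤ m x
... | true  | _       = nonLRMaxFrom-linked linked
... | false | ofⁿ m≰x = contradiction m≤x m≰x

nonLRMax-identity : ∀ n → nonLRMax (identity n) ≡ 0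
nonLRMax-identity n rewrite map-upTo suc n =
  nonLRMaxFrom-linked (applyUpTo⁺₂ id (suc n) n≤1+n)

lemma1 : (n p : ℕ) → 1 ≤ n → (σ : List ℕ) → Jumps p (identity n) σ → nonLRMax σ ≤ p
lemma1 n p _ σ js = begin
  nonLRMax σ                   ≤⟨ nonLRMax-Jumps js ⟩
  p + nonLRMax (identity n)    ≡⟨ cong (p +_) (nonLRMax-identity n) ⟩
  p + 0                        ≡⟨ +-identityʳ p ⟩
  p                            ∎
  where open ≤-Reasoning
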